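{- Let $k\in\mathbb N$ and $G$ a graph. If $G$ contains a $k$-apex structure, then $G$ has a $k$-edge induced subgraph.
   Context: Graphs are simple, finite, with nonempty vertex set. A $k$-edge induced subgraph of $G$ is $G[S]$ for some nonempty $S\subseteq V(G)$ with exactly $k$ edges. $\mathscr R_k$ denotes the Ramsey number: every graph with at least $\mathscr R_k$ vertices has a clique of size $k$ or an independent set of size $k$. $G=(V,E)$ contains a $k$-apex structure on $v_0\in V$ and $A,B\subseteq V$ if: (A1) $A,B$ are disjoint, $|A|\ge k$, $|B|\ge\mathscr R_k$; (A2) $A$ is a clique in $G$; (A3) $\{u,v_0\}\in E$ for every $u\in A$ and $\{v,v_0\}\notin E$ for every $v\in B$ (so $v_0\notin A$, while $v_0\in B$ is possible); (A4) $\{u,v\}\in E$ for all $u\in A$, $v\in B$. -}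

module Defs where

open import Data.Nat using (ℕ; zero; suc; _≤_)
open import Data.Bool using (Bool; true; false; _∧_; if_then_else_)
open import Data.Fin using (Fin; toℕ)
open import Data.Fin.Subset using (Subset; _∈_; _∉_; ∣_∣; Nonempty)
open import Data.Vec using (lookup)
open import Data.List using (List; map; allFin)
open import Data.Nat.ListAction using (sum)
open import Data.Product using (Σ; ∃; _×_)
open import Data.Sum using (_⊎_)
open import Relation.Binary.PropositionalEquality using (_≡_; _≢_)
open import Data.Nat.Base using (_<ᵇ_)

record Graph : Set where
  field
    n      : ℕ
    nonempty : 1 ≤ n
    adj    : Fin n → Fin n → Bool
    adj-sym    : ∀ u v → adj u v ≡ adj v u
    adj-irrefl : ∀ u → adj u u ≡ false

open Graph public

Edge : (G : Graph) → Fin (n G) → Fin (n G) → Set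
Edge G u v = adj G u v ≡ true

edgeCount : (G : Graph) → Subset (n G) → ℕ
edgeCount G S =
  sum (map (λ u → sum (map (λ v →
    if (toℕ u <ᵇ toℕ v) ∧ lookup S u ∧ lookup S v ∧ adj G u v then 1 else 0)
      (allFin (n G)))) (allFin (n G)))

HasKEdgeInducedSubgraph : ℕ → Graph → Set
HasKEdgeInducedSubgraph k G = ∃ λ (S : Subset (n G)) → Nonempty S × edgeCount G S ≡ k

IsClique : (G : Graph) → Subset (n G) → Set
IsClique G A = ∀ u v → u ∈ A → v ∈ A → u ≢ v → Edge G u v

IsIndependent : (G : Graph) → Subset (n G) → Set
IsIndependent G A = ∀ u v → u ∈ A → v ∈ A → adj G u v ≡ false

RamseyProperty : ℕ → ℕ → Set
RamseyProperty k r = (H : Graph) → r ≤ n H →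
  ∃ λ (S : Subset (n H)) → ∣ S ∣ ≡ k × (IsClique H S ⊎ IsIndependent H S)

IsRamseyNumber : ℕ → ℕ → Set
IsRamseyNumber k r = RamseyProperty k r × (∀ r′ → RamseyProperty k r′ → r ≤ r′)

-- G contains a k-apex structure on v₀, A, B, where r = ℛ_k
record ApexStructure (k r : ℕ) (G : Graph) (v₀ : Fin (n G)) (A B : Subset (n G)) : Set where
  field
    disjoint : ∀ u → u ∈ A → u ∉ B
    A-size   : k ≤ ∣ A ∣
    B-size   : r ≤ ∣ B ∣
    A-clique : IsClique G A
    A-v₀     : ∀ u → u ∈ A → Edge G u v₀
    B-v₀     : ∀ v → v ∈ B → adj G v v₀ ≡ false
    A-B      : ∀ u v → u ∈ A → v ∈ B → Edge G u v

-- By Ramsey, B contains k vertices K spanning a clique or an independent set.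
-- If K is independent, one vertex of A together with K spans exactly k edges,
-- since A is complete to B.  If K is a clique, write k = a + (a + d) C 2 with
-- d < k; then v₀, a vertices of A and d vertices of K induce a clique on a + d
-- vertices plus the a edges at v₀, because v₀ has no neighbour in B.
-- Edge counts are computed on duplicate-free vertex lists, where adding a vertex
-- adds its number of neighbours in the list.

module Submission where

open import Defs
open import Function using (_∘_; id)
open import Data.Nat using (ℕ; zero; suc; _+_; _≤_; _<_; _<ᵇ_; z≤n; s≤s)
open import Data.Nat.Properties
  using ( suc-injective; +-identityʳ; +-suc; +-assoc; +-commutativeSemigroup
        ; ≤-trans; m≤m+n; m<n⇒m≤1+n; m≤n⇒m⊓n≡m )
open import Algebra.Properties.CommutativeSemigroup +-commutativeSemigroup
  using (x∙yz≈y∙xz; interchange)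
open import Data.Nat.Combinatorics using (_C_; nC1≡n; nCk+nC[k+1]≡[n+1]C[k+1])
open import Data.Nat.ListAction using (sum)
open import Data.Nat.ListAction.Properties using (sum-++)
open import Data.Bool using (Bool; true; false; _∧_; if_then_else_)
open import Data.Bool.Properties using (∧-zeroʳ; ∧-identityʳ)
open import Data.Fin using (Fin; zero; suc; toℕ)
open import Data.Fin.Properties as Fin using (toℕ-injective)
open import Data.Fin.Subset using (Subset; inside; outside; ⊥; _∈_; _∉_; ∣_∣; Nonempty)
open import Data.Fin.Subset.Properties using (∣p∣≤n)
open import Data.Vec using ([]; _∷_; lookup; _[_]≔_; here; there)
open import Data.Vec.Properties using (lookup-replicate; lookup∘update′; []≔-updates)
open import Data.List as List using (List; []; _∷_; _++_; map; length; take; allFin)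
open import Data.List.Properties
  using (map-tabulate; map-cong; map-cong-local; map-++; length-map; length-++; length-take)
open import Data.List.Membership.Propositional.Properties using (∈-lookup)
open import Data.List.Relation.Unary.All as All using (All; []; _∷_)
import Data.List.Relation.Unary.All.Properties as All
open import Data.List.Relation.Unary.AllPairs using (AllPairs; []; _∷_)
import Data.List.Relation.Unary.AllPairs.Properties as AllPairs
open import Data.List.Relation.Unary.Unique.Propositional using (Unique)
import Data.List.Relation.Unary.Unique.Propositional.Properties as Unique
open import Data.Product using (∃; ∃₂; _×_; _,_)
open import Data.Sum as Sum using (_⊎_; inj₁; inj₂)
open import Relation.Nullary using (contradiction)
open import Relation.Binary.PropositionalEquality
  using (_≡_; _≢_; refl; sym; trans; cong; cong₂; subst; module ≡-Reasoning)

open ≡-Reasoning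

𝟙 : Bool → ℕ
𝟙 b = if b then 1 else 0

sum-map-+ : ∀ {a} {A : Set a} (f g : A → ℕ) xs →
  sum (map (λ x → f x + g x) xs) ≡ sum (map f xs) + sum (map g xs)
sum-map-+ f g []       = refl
sum-map-+ f g (x ∷ xs) = trans (cong (f x + g x +_) (sum-map-+ f g xs)) (interchange (f x) (g x) _ _)

sum-map-0 : ∀ {a} {A : Set a} {f : A → ℕ} xs → (∀ x → f x ≡ 0) → sum (map f xs) ≡ 0
sum-map-0 []       f≡0 = refl
sum-map-0 (x ∷ xs) f≡0 = cong₂ _+_ (f≡0 x) (sum-map-0 xs f≡0)

sum-map-allFin-suc : ∀ {m} (h : Fin (suc m) → ℕ) →
  sum (map h (allFin (suc m))) ≡ h zero + sum (map (h ∘ suc) (allFin m))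
sum-map-allFin-suc h =
  trans (cong sum (map-tabulate id h)) (cong (λ xs → h zero + sum xs) (sym (map-tabulate id (h ∘ suc))))

∑∈ : ∀ {m} → Subset m → (Fin m → ℕ) → ℕ
∑∈ []            g = 0
∑∈ (inside  ∷ S) g = g zero + ∑∈ S (g ∘ suc)
∑∈ (outside ∷ S) g = ∑∈ S (g ∘ suc)

syntax ∑∈ S (λ u → e) = ∑[ u ∈ S ] e

∑∈-allFin : ∀ {m} (S : Subset m) (g : Fin m → ℕ) →
  sum (map (λ u → if lookup S u then g u else 0) (allFin m)) ≡ ∑∈ S g
∑∈-allFin []            g = refl
∑∈-allFin (inside  ∷ S) g =
  trans (sum-map-allFin-suc (λ u → if lookup (inside ∷ S) u then g u else 0))
        (cong (g zero +_) (∑∈-allFin S (g ∘ suc)))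
∑∈-allFin (outside ∷ S) g =
  trans (sum-map-allFin-suc (λ u → if lookup (outside ∷ S) u then g u else 0))
        (∑∈-allFin S (g ∘ suc))

∑∈-⊥ : ∀ m (g : Fin m → ℕ) → ∑∈ ⊥ g ≡ 0
∑∈-⊥ zero    g = refl
∑∈-⊥ (suc m) g = ∑∈-⊥ m (g ∘ suc)

∑∈-insert : ∀ {m} (S : Subset m) {x} (g : Fin m → ℕ) → lookup S x ≡ outside →
  ∑∈ (S [ x ]≔ inside) g ≡ g x + ∑∈ S g
∑∈-insert (inside  ∷ S) {zero}  g ()
∑∈-insert (outside ∷ S) {zero}  g _   = refl
∑∈-insert (inside  ∷ S) {suc x} g x∉S =
  trans (cong (g zero +_) (∑∈-insert S (g ∘ suc) x∉S)) (x∙yz≈y∙xz (g zero) (g (suc x)) _)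
∑∈-insert (outside ∷ S) {suc x} g x∉S = ∑∈-insert S (g ∘ suc) x∉S

fromList : ∀ {m} → List (Fin m) → Subset m
fromList []       = ⊥
fromList (x ∷ xs) = fromList xs [ x ]≔ inside

fromList-nonempty : ∀ {m} (x : Fin m) xs → Nonempty (fromList (x ∷ xs))
fromList-nonempty x xs = x , []≔-updates (fromList xs) x

lookup-fromList-∉ : ∀ {m} {x : Fin m} {xs} → All (x ≢_) xs → lookup (fromList xs) x ≡ outside
lookup-fromList-∉ {x = x} [] = lookup-replicate x outside
lookup-fromList-∉ {xs = y ∷ ys} (x≢y ∷ x∉ys) =
  trans (lookup∘update′ x≢y (fromList ys) inside) (lookup-fromList-∉ x∉ys)

∑∈-fromList : ∀ {m} {xs : List (Fin m)} (g : Fin m → ℕ) → Unique xs →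
  ∑∈ (fromList xs) g ≡ sum (map g xs)
∑∈-fromList g [] = ∑∈-⊥ _ g
∑∈-fromList {xs = x ∷ xs} g (x∉xs ∷ xs!) =
  trans (∑∈-insert (fromList xs) g (lookup-fromList-∉ x∉xs)) (cong (g x +_) (∑∈-fromList g xs!))

toList : ∀ {m} → Subset m → List (Fin m)
toList []            = []
toList (inside  ∷ p) = zero ∷ map suc (toList p)
toList (outside ∷ p) = map suc (toList p)

length-toList : ∀ {m} (p : Subset m) → length (toList p) ≡ ∣ p ∣
length-toList []            = refl
length-toList (inside  ∷ p) = cong suc (trans (length-map suc (toList p)) (length-toList p))
length-toList (outside ∷ p) = trans (length-map suc (toList p)) (length-toList p)

toList-unique : ∀ {m} (p : Subset m) → Unique (toList p)
toList-unique []            = []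
toList-unique (inside  ∷ p) =
  All.map⁺ (All.universal (λ _ ()) (toList p)) ∷ Unique.map⁺ Fin.suc-injective (toList-unique p)
toList-unique (outside ∷ p) = Unique.map⁺ Fin.suc-injective (toList-unique p)

toList-∈ : ∀ {m} (p : Subset m) → All (_∈ p) (toList p)
toList-∈ []            = []
toList-∈ (inside  ∷ p) = here ∷ All.map⁺ (All.map there (toList-∈ p))
toList-∈ (outside ∷ p) = All.map⁺ (All.map there (toList-∈ p))

0<∣p∣⇒Nonempty : ∀ {m} (p : Subset m) → 0 < ∣ p ∣ → Nonempty p
0<∣p∣⇒Nonempty (inside  ∷ p) _     = zero , here
0<∣p∣⇒Nonempty (outside ∷ p) 0<∣p∣ = let x , x∈p = 0<∣p∣⇒Nonempty p 0<∣p∣ in suc x , there x∈p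

lookup-injective : ∀ {a} {A : Set a} {xs : List A} → Unique xs →
  ∀ {i j} → List.lookup xs i ≡ List.lookup xs j → i ≡ j
lookup-injective (_ ∷ _) {zero} {zero} _ = refl
lookup-injective (x∉xs ∷ _) {zero} {suc j} eq = contradiction eq (All.lookup x∉xs (∈-lookup j))
lookup-injective (x∉xs ∷ _) {suc i} {zero} eq = contradiction (sym eq) (All.lookup x∉xs (∈-lookup i))
lookup-injective (_ ∷ xs!) {suc i} {suc j} eq = cong suc (lookup-injective xs! eq)

Unique⇒AllPairs : ∀ {a p r} {A : Set a} {P : A → Set p} {R : A → A → Set r} →
  (∀ {x y} → P x → P y → x ≢ y → R x y) → ∀ {xs} → All P xs → Unique xs → AllPairs R xs
Unique⇒AllPairs R-≢ []         []           = []
Unique⇒AllPairs R-≢ (px ∷ pxs) (x∉xs ∷ xs!) =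
  All.zipWith (λ (py , x≢y) → R-≢ px py x≢y) (pxs , x∉xs) ∷ Unique⇒AllPairs R-≢ pxs xs!

𝟙<ᵇ-flip : ∀ {i j} → i ≢ j → 𝟙 (i <ᵇ j) + 𝟙 (j <ᵇ i) ≡ 1
𝟙<ᵇ-flip {zero}  {zero}  i≢j = contradiction refl i≢j
𝟙<ᵇ-flip {zero}  {suc j} _   = refl
𝟙<ᵇ-flip {suc i} {zero}  _   = refl
𝟙<ᵇ-flip {suc i} {suc j} i≢j = 𝟙<ᵇ-flip (i≢j ∘ cong suc)

NonEdge : (G : Graph) → Fin (n G) → Fin (n G) → Set
NonEdge G u v = adj G u v ≡ false

degreeIn : (G : Graph) → Fin (n G) → List (Fin (n G)) → ℕ
degreeIn G x ys = sum (map (λ y → 𝟙 (adj G x y)) ys)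

edgesAmong : (G : Graph) → List (Fin (n G)) → ℕ
edgesAmong G []       = 0
edgesAmong G (x ∷ xs) = degreeIn G x xs + edgesAmong G xs

orderedEdge : (G : Graph) → Fin (n G) → Fin (n G) → ℕ
orderedEdge G u v = 𝟙 ((toℕ u <ᵇ toℕ v) ∧ adj G u v)

orderedEdge-irrefl : ∀ G x → orderedEdge G x x ≡ 0
orderedEdge-irrefl G x rewrite adj-irrefl G x = cong 𝟙 (∧-zeroʳ _)

orderedEdge-flip : ∀ G {u v} → u ≢ v → orderedEdge G u v + orderedEdge G v u ≡ 𝟙 (adj G u v)
orderedEdge-flip G {u} {v} u≢v rewrite adj-sym G v u with adj G u v
... | true  = trans (cong₂ _+_ (cong 𝟙 (∧-identityʳ (toℕ u <ᵇ toℕ v)))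
                               (cong 𝟙 (∧-identityʳ (toℕ v <ᵇ toℕ u))))
                    (𝟙<ᵇ-flip (u≢v ∘ toℕ-injective))
... | false = cong₂ _+_ (cong 𝟙 (∧-zeroʳ (toℕ u <ᵇ toℕ v))) (cong 𝟙 (∧-zeroʳ (toℕ v <ᵇ toℕ u)))

edgeCount≡∑∈ : ∀ G S → edgeCount G S ≡ ∑[ u ∈ S ] ∑[ v ∈ S ] orderedEdge G u v
edgeCount≡∑∈ G S =
  trans (cong sum (map-cong row (allFin (n G)))) (∑∈-allFin S (λ u → ∑[ v ∈ S ] orderedEdge G u v))
  where
  row : ∀ u → sum (map (λ v → 𝟙 ((toℕ u <ᵇ toℕ v) ∧ lookup S u ∧ lookup S v ∧ adj G u v)) (allFin (n G)))
            ≡ (if lookup S u then ∑[ v ∈ S ] orderedEdge G u v else 0)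
  row u with lookup S u
  ... | false = sum-map-0 (allFin (n G)) (λ _ → cong 𝟙 (∧-zeroʳ _))
  ... | true  = trans (cong sum (map-cong entry (allFin (n G)))) (∑∈-allFin S _)
    where
    entry : ∀ v → 𝟙 ((toℕ u <ᵇ toℕ v) ∧ lookup S v ∧ adj G u v)
                ≡ (if lookup S v then orderedEdge G u v else 0)
    entry v with lookup S v
    ... | true  = refl
    ... | false = cong 𝟙 (∧-zeroʳ _)

sum-map-sum-map-∷ : ∀ {a} {A : Set a} (w : A → A → ℕ) x xs →
  sum (map (λ u → sum (map (w u) (x ∷ xs))) (x ∷ xs))
    ≡ w x x + (sum (map (λ v → w x v + w v x) xs) + sum (map (λ u → sum (map (w u) xs)) xs))
sum-map-sum-map-∷ w x xs = begin
  (w x x + ∑wx) + sum (map (λ u → w u x + sum (map (w u) xs)) xs)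
    ≡⟨ cong ((w x x + ∑wx) +_) (sum-map-+ (λ u → w u x) (λ u → sum (map (w u) xs)) xs) ⟩
  (w x x + ∑wx) + (∑xw + ∑∑w)       ≡⟨ +-assoc (w x x) ∑wx _ ⟩
  w x x + (∑wx + (∑xw + ∑∑w))       ≡⟨ cong (w x x +_) (sym (+-assoc ∑wx ∑xw ∑∑w)) ⟩
  w x x + ((∑wx + ∑xw) + ∑∑w)
    ≡⟨ cong (λ t → w x x + (t + ∑∑w)) (sym (sum-map-+ (w x) (λ v → w v x) xs)) ⟩
  w x x + (sum (map (λ v → w x v + w v x) xs) + ∑∑w) ∎
  where
  ∑wx = sum (map (w x) xs)
  ∑xw = sum (map (λ u → w u x) xs)
  ∑∑w = sum (map (λ u → sum (map (w u) xs)) xs)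

∑∑-orderedEdge : ∀ G {xs} → Unique xs →
  sum (map (λ u → sum (map (orderedEdge G u) xs)) xs) ≡ edgesAmong G xs
∑∑-orderedEdge G {[]} [] = refl
∑∑-orderedEdge G {x ∷ xs} (x∉xs ∷ xs!) =
  trans (sum-map-sum-map-∷ (orderedEdge G) x xs)
        (cong₂ _+_ (orderedEdge-irrefl G x)
                   (cong₂ _+_ (cong sum (map-cong-local (All.map (orderedEdge-flip G) x∉xs)))
                              (∑∑-orderedEdge G xs!)))

edgeCount-fromList : ∀ G {xs} → Unique xs → edgeCount G (fromList xs) ≡ edgesAmong G xs
edgeCount-fromList G {xs} xs! = begin
  edgeCount G S                                         ≡⟨ edgeCount≡∑∈ G S ⟩
  ∑[ u ∈ S ] ∑[ v ∈ S ] orderedEdge G u v               ≡⟨ ∑∈-fromList _ xs! ⟩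
  sum (map (λ u → ∑[ v ∈ S ] orderedEdge G u v) xs)
    ≡⟨ cong sum (map-cong (λ u → ∑∈-fromList (orderedEdge G u) xs!) xs) ⟩
  sum (map (λ u → sum (map (orderedEdge G u) xs)) xs)  ≡⟨ ∑∑-orderedEdge G xs! ⟩
  edgesAmong G xs                                       ∎
  where
  S = fromList xs

fromList-witness : ∀ G {x xs} → Unique (x ∷ xs) → HasKEdgeInducedSubgraph (edgesAmong G (x ∷ xs)) G
fromList-witness G {x} {xs} xs! = fromList (x ∷ xs) , fromList-nonempty x xs , edgeCount-fromList G xs!

degreeIn-++ : ∀ G x ys zs → degreeIn G x (ys ++ zs) ≡ degreeIn G x ys + degreeIn G x zs
degreeIn-++ G x ys zs =
  trans (cong sum (map-++ (λ y → 𝟙 (adj G x y)) ys zs)) (sum-++ (map (λ y → 𝟙 (adj G x y)) ys) _)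

degreeIn-complete : ∀ G {x ys} → All (Edge G x) ys → degreeIn G x ys ≡ length ys
degreeIn-complete G []       = refl
degreeIn-complete G (e ∷ es) = cong₂ _+_ (cong 𝟙 e) (degreeIn-complete G es)

degreeIn-none : ∀ G {x ys} → All (NonEdge G x) ys → degreeIn G x ys ≡ 0
degreeIn-none G []       = refl
degreeIn-none G (e ∷ es) = cong₂ _+_ (cong 𝟙 e) (degreeIn-none G es)

edgesAmong-clique : ∀ G {xs} → AllPairs (Edge G) xs → edgesAmong G xs ≡ length xs C 2
edgesAmong-clique G []                      = refl
edgesAmong-clique G {x ∷ xs} (x~xs ∷ xs~) = begin
  degreeIn G x xs + edgesAmong G xs
    ≡⟨ cong₂ _+_ (trans (degreeIn-complete G x~xs) (sym (nC1≡n _))) (edgesAmong-clique G xs~) ⟩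
  length xs C 1 + length xs C 2      ≡⟨ nCk+nC[k+1]≡[n+1]C[k+1] (length xs) 1 ⟩
  suc (length xs) C 2                ∎

edgesAmong-independent : ∀ G {xs} → AllPairs (NonEdge G) xs → edgesAmong G xs ≡ 0
edgesAmong-independent G []                = refl
edgesAmong-independent G (x≁xs ∷ xs≁) = cong₂ _+_ (degreeIn-none G x≁xs) (edgesAmong-independent G xs≁)

inducedOn : (G : Graph) (xs : List (Fin (n G))) → 0 < length xs → Graph
inducedOn G xs 0<|xs| = record
  { n          = length xs
  ; nonempty   = 0<|xs|
  ; adj        = λ i j → adj G (List.lookup xs i) (List.lookup xs j)
  ; adj-sym    = λ i j → adj-sym G (List.lookup xs i) (List.lookup xs j)
  ; adj-irrefl = λ i → adj-irrefl G (List.lookup xs i)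
  }

module _ (G : Graph) (xs : List (Fin (n G))) (0<|xs| : 0 < length xs) (T : Subset (length xs)) where

  private
    H = inducedOn G xs 0<|xs|

  image-clique : IsClique H T → AllPairs (Edge G) (map (List.lookup xs) (toList T))
  image-clique T-clique = AllPairs.map⁺
    (Unique⇒AllPairs (λ i∈T j∈T i≢j → T-clique _ _ i∈T j∈T i≢j) (toList-∈ T) (toList-unique T))

  image-independent : IsIndependent H T → AllPairs (NonEdge G) (map (List.lookup xs) (toList T))
  image-independent T-independent = AllPairs.map⁺
    (Unique⇒AllPairs (λ i∈T j∈T _ → T-independent _ _ i∈T j∈T) (toList-∈ T) (toList-unique T))

RamseyProperty⇒0<r : ∀ {m r} → RamseyProperty (2 + m) r → 0 < r
RamseyProperty⇒0<r {r = suc r} _      = s≤s z≤n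
RamseyProperty⇒0<r {r = zero}  ramsey =
  let S , ∣S∣≡2+m , _ = ramsey K₁ z≤n
  in contradiction (subst (_≤ 1) ∣S∣≡2+m (∣p∣≤n S)) λ { (s≤s ()) }
  where
  K₁ : Graph
  K₁ = record { n = 1 ; nonempty = s≤s z≤n ; adj = λ _ _ → false
              ; adj-sym = λ _ _ → refl ; adj-irrefl = λ _ → refl }

ramsey-in-subset : ∀ {k r} → RamseyProperty k r →
  (G : Graph) (B : Subset (n G)) → r ≤ ∣ B ∣ → 0 < ∣ B ∣ →
  ∃ λ K → Unique K × length K ≡ k × All (_∈ B) K × (AllPairs (Edge G) K ⊎ AllPairs (NonEdge G) K)
ramsey-in-subset {r = r} ramsey G B r≤∣B∣ 0<∣B∣ =
  let T , ∣T∣≡k , clique-or-independent = ramsey H (subst (r ≤_) (sym (length-toList B)) r≤∣B∣)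
  in map (List.lookup bs) (toList T) ,
     Unique.map⁺ (lookup-injective (toList-unique B)) (toList-unique T) ,
     trans (length-map _ (toList T)) (trans (length-toList T) ∣T∣≡k) ,
     All.map⁺ (All.universal (λ i → All.lookup (toList-∈ B) (∈-lookup {xs = bs} i)) (toList T)) ,
     Sum.map (image-clique G bs 0<∣bs∣ T) (image-independent G bs 0<∣bs∣ T) clique-or-independent
  where
  bs = toList B
  0<∣bs∣ = subst (0 <_) (sym (length-toList B)) 0<∣B∣
  H = inducedOn G bs 0<∣bs∣

binomial-decomposition : ∀ m → ∃₂ λ d a → d ≤ m × a + (a + d) C 2 ≡ suc m
binomial-decomposition zero = 0 , 1 , z≤n , refl
binomial-decomposition (suc m) with binomial-decomposition m
... | zero , a , _ , eq = a , 1 , subst (a ≤_) eq (m≤m+n a _) , cong suc (begin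
  suc a C 2               ≡⟨ nCk+nC[k+1]≡[n+1]C[k+1] a 1 ⟨
  a C 1 + a C 2           ≡⟨ cong₂ _+_ (nC1≡n a) (cong (_C 2) (sym (+-identityʳ a))) ⟩
  a + (a + 0) C 2         ≡⟨ eq ⟩
  suc m                   ∎)
... | suc d , a , d<m , eq = d , suc a , m<n⇒m≤1+n d<m ,
  cong suc (trans (cong (λ t → a + t C 2) (sym (+-suc a d))) eq)

module _ {k r : ℕ} {G : Graph} {v₀ : Fin (n G)} {A B : Subset (n G)} (apex : ApexStructure k r G v₀ A B) where

  open ApexStructure apex

  v₀∉A : v₀ ∉ A
  v₀∉A v₀∈A = contradiction (trans (sym (A-v₀ v₀ v₀∈A)) (adj-irrefl G v₀)) λ ()

  -- v₀ followed by a clique on a vertices of A and the vertices of D; v₀ sees exactly the a.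
  apex-witness : ∀ {D} → Unique D → All (_∈ B) D → All (v₀ ≢_) D → AllPairs (Edge G) D →
    ∀ {a} → a ≤ ∣ A ∣ → HasKEdgeInducedSubgraph (a + (a + length D) C 2) G
  apex-witness {D} D! D⊆B v₀∉D D-clique {a} a≤∣A∣ =
    subst (λ e → HasKEdgeInducedSubgraph e G) edges (fromList-witness G S!)
    where
    as = take a (toList A)
    as⊆A : All (_∈ A) as
    as⊆A = All.take⁺ a (toList-∈ A)
    as! : Unique as
    as! = Unique.take⁺ a (toList-unique A)
    ∣as∣ : length as ≡ a
    ∣as∣ = trans (length-take a _) (m≤n⇒m⊓n≡m (subst (a ≤_) (sym (length-toList A)) a≤∣A∣))
    S! : Unique (v₀ ∷ as ++ D)
    S! = All.++⁺ (All.map (λ u∈A v₀≡u → v₀∉A (subst (_∈ A) (sym v₀≡u) u∈A)) as⊆A) v₀∉D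
       ∷ Unique.++⁺ as! D! (λ (u∈as , u∈D) → disjoint _ (All.lookup as⊆A u∈as) (All.lookup D⊆B u∈D))
    as++D-clique : AllPairs (Edge G) (as ++ D)
    as++D-clique = AllPairs.++⁺
      (Unique⇒AllPairs (λ u∈A w∈A u≢w → A-clique _ _ u∈A w∈A u≢w) as⊆A as!)
      D-clique
      (All.map (λ u∈A → All.map (A-B _ _ u∈A) D⊆B) as⊆A)
    v₀~as : All (Edge G v₀) as
    v₀~as = All.map (λ u∈A → trans (adj-sym G v₀ _) (A-v₀ _ u∈A)) as⊆A
    v₀≁D : All (NonEdge G v₀) D
    v₀≁D = All.map (λ w∈B → trans (adj-sym G v₀ _) (B-v₀ _ w∈B)) D⊆B
    edges : edgesAmong G (v₀ ∷ as ++ D) ≡ a + (a + length D) C 2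
    edges = begin
      degreeIn G v₀ (as ++ D) + edgesAmong G (as ++ D)
        ≡⟨ cong₂ _+_ (degreeIn-++ G v₀ as D) (edgesAmong-clique G as++D-clique) ⟩
      (degreeIn G v₀ as + degreeIn G v₀ D) + length (as ++ D) C 2
        ≡⟨ cong₂ _+_ (cong₂ _+_ (degreeIn-complete G v₀~as) (degreeIn-none G v₀≁D))
                     (cong (_C 2) (length-++ as)) ⟩
      (length as + 0) + (length as + length D) C 2
        ≡⟨ cong₂ _+_ (trans (+-identityʳ _) ∣as∣) (cong (λ t → (t + length D) C 2) ∣as∣) ⟩
      a + (a + length D) C 2 ∎

  independent-witness : ∀ {K} → Unique K → All (_∈ B) K → AllPairs (NonEdge G) K → 0 < ∣ A ∣ →
    HasKEdgeInducedSubgraph (length K) G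
  independent-witness {K} K! K⊆B K-independent 0<∣A∣ =
    let u , u∈A = 0<∣p∣⇒Nonempty A 0<∣A∣
        u∉K = All.map (λ v∈B u≡v → disjoint _ u∈A (subst (_∈ B) (sym u≡v) v∈B)) K⊆B
        edges = trans (cong₂ _+_ (degreeIn-complete G (All.map (A-B _ _ u∈A) K⊆B))
                                 (edgesAmong-independent G K-independent))
                      (+-identityʳ _)
    in subst (λ e → HasKEdgeInducedSubgraph e G) edges (fromList-witness G (u∉K ∷ K!))

  clique-witness : ∀ {K} → Unique K → All (_∈ B) K → AllPairs (Edge G) K →
    ∀ {d a} → d < length K → a ≤ ∣ A ∣ → HasKEdgeInducedSubgraph (a + (a + d) C 2) G
  clique-witness {y ∷ K} (_ ∷ K!) (y∈B ∷ K⊆B) (y~K ∷ K-clique) {d} {a} (s≤s d≤∣K∣) a≤∣A∣ =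
    subst (λ t → HasKEdgeInducedSubgraph (a + (a + t) C 2) G)
          (trans (length-take d K) (m≤n⇒m⊓n≡m d≤∣K∣))
          (apex-witness (Unique.take⁺ d K!) (All.take⁺ d K⊆B) (All.take⁺ d v₀∉K)
                        (AllPairs.take⁺ d K-clique) a≤∣A∣)
    where
    -- The neighbours of y ∈ B avoid v₀, which has no neighbour in B.
    v₀∉K : All (v₀ ≢_) K
    v₀∉K = All.map (λ y~x v₀≡x → contradiction
      (trans (sym y~x) (subst (λ z → adj G y z ≡ false) v₀≡x (B-v₀ y y∈B))) λ ()) y~K

open ApexStructure using (A-size; B-size)

lemma3p6 : (k r : ℕ) → IsRamseyNumber k r → (G : Graph) →
    (∃ λ (v₀ : Fin (n G)) → ∃ λ (A : Subset (n G)) → ∃ λ (B : Subset (n G)) →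
    ApexStructure k r G v₀ A B) →
    HasKEdgeInducedSubgraph k G
lemma3p6 zero _ _ _ (_ , _ , _ , apex) = apex-witness apex [] [] [] [] z≤n
lemma3p6 1    _ _ _ (_ , _ , _ , apex) = apex-witness apex [] [] [] [] (A-size apex)
lemma3p6 (suc (suc m)) _ (ramsey , _) G (_ , _ , B , apex)
  with ramsey-in-subset ramsey G B (B-size apex) (≤-trans (RamseyProperty⇒0<r ramsey) (B-size apex))
... | K , K! , ∣K∣ , K⊆B , inj₂ K-independent =
  subst (λ e → HasKEdgeInducedSubgraph e G) ∣K∣
    (independent-witness apex K! K⊆B K-independent (≤-trans (s≤s z≤n) (A-size apex)))
... | K , K! , ∣K∣ , K⊆B , inj₁ K-clique =
  let d , a , d≤1+m , decomposition = binomial-decomposition (suc m)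
      d<∣K∣ = subst (d <_) (sym ∣K∣) (s≤s d≤1+m)
      a≤∣A∣ = ≤-trans (subst (a ≤_) decomposition (m≤m+n a _)) (A-size apex)
  in subst (λ e → HasKEdgeInducedSubgraph e G) decomposition
       (clique-witness apex K! K⊆B K-clique d<∣K∣ a≤∣A∣)
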